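{- Let $m\ge1$, let $\delta_m=m(m-1)\cdots21$, and let $v$ be any word over $[m]=\{1,\dots,m\}$. Then for all $i\in[m]$, $$R_i(\delta_m v)=i\,R_i(v),$$ i.e. the $i$th row of $P(\delta_m v)$ is the letter $i$ followed by the entries of the $i$th row of $P(v)$.
   Context: Juxtaposition denotes concatenation of words. $P(w)$ is the insertion tableau of $w$ under the Robinson–Schensted–Knuth (row-insertion) correspondence. $R_i(w)$ denotes the $i$th row of $P(w)$, read as a word from left to right (empty if $P(w)$ has fewer than $i$ rows). -}

module Defs where

open import Data.Nat using (ℕ; zero; suc; _≤_; _<_; _<ᵇ_)
open import Data.Bool using (if_then_else_)
open import Data.List using (List; []; _∷_; _++_; foldl)
open import Data.Maybe using (Maybe; just; nothing)
open import Data.Product using (_×_; _,_)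

-- A word is a list of letters (positive naturals); juxtaposition is _++_.
Word : Set
Word = List ℕ

-- A tableau is the list of its rows (top row first), each row read left to right.
Tableau : Set
Tableau = List (List ℕ)

rowInsert : ℕ → List ℕ → List ℕ × Maybe ℕ
rowInsert x [] = (x ∷ [] , nothing)
rowInsert x (y ∷ ys) =
  if x <ᵇ y
    then (x ∷ ys , just y)
    else (let r , b = rowInsert x ys in (y ∷ r , b))

insert : ℕ → Tableau → Tableau
insert x [] = (x ∷ []) ∷ []
insert x (row ∷ rows) with rowInsert x row
... | row' , nothing = row' ∷ rows
... | row' , just y  = row' ∷ insert y rows

P : Word → Tableau
P w = foldl (λ T x → insert x T) [] w

-- i-th row (1-indexed) of a tableau, empty if there are fewer than i rows.
row : ℕ → Tableau → List ℕ
row zero T = []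
row (suc zero) [] = []
row (suc zero) (r ∷ rs) = r
row (suc (suc i)) [] = []
row (suc (suc i)) (r ∷ rs) = row (suc i) rs

R : ℕ → Word → List ℕ
R i w = row i (P w)

δ : ℕ → Word
δ zero = []
δ (suc m) = suc m ∷ δ m

{-# OPTIONS --safe #-}
-- P(δ_m) is the single column 1, 2, …, m.  Inserting a letter a ≥ 1 into a
-- tableau whose first column is k, k+1, …, k+n−1 never disturbs that column:
-- a does not bump the first-row entry k, and the letter it does bump is > a ≥ k,
-- so it does not bump the second-row entry k+1, and so on.  Hence P(δ_m v) is
-- P(v) with the column 1, …, m glued onto its left.
module Submission where

open import Defs
open import Data.Bool using (true; false)
open import Data.List using (List; []; _∷_; _++_; foldl)
open import Data.List.Properties using (foldl-++)
open import Data.List.Relation.Unary.All as All using (All; []; _∷_)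
open import Data.Maybe using (just; nothing)
open import Data.Nat using (ℕ; zero; suc; _+_; _≤_; _<_; _<ᵇ_; z≤n; s≤s)
open import Data.Nat.Properties using (+-suc; +-identityʳ; ≤-trans; <ᵇ⇒<)
open import Data.Product using (_×_; _,_; proj₁)
open import Function using (flip)
open import Relation.Binary.PropositionalEquality
  using (_≡_; refl; cong; module ≡-Reasoning)

≤⇒≮ᵇ : ∀ {m n} → m ≤ n → (n <ᵇ m) ≡ false
≤⇒≮ᵇ z≤n       = refl
≤⇒≮ᵇ (s≤s m≤n) = ≤⇒≮ᵇ m≤n

n<ᵇ1+n : ∀ n → (n <ᵇ suc n) ≡ true
n<ᵇ1+n zero    = refl
n<ᵇ1+n (suc n) = n<ᵇ1+n n

rowInsert-bumps-larger : ∀ x r {r′ z} → rowInsert x r ≡ (r′ , just z) → x < z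
rowInsert-bumps-larger x []       ()
rowInsert-bumps-larger x (y ∷ ys) eq with x <ᵇ y | <ᵇ⇒< x y
rowInsert-bumps-larger x (y ∷ ys) refl | true  | x<y = x<y _
rowInsert-bumps-larger x (y ∷ ys) eq   | false | _ with rowInsert x ys in eq′
rowInsert-bumps-larger x (y ∷ ys) refl | false | _ | _ , just _ = rowInsert-bumps-larger x ys eq′

prependColumn : ℕ → ℕ → Tableau → Tableau
prependColumn k zero    T        = T
prependColumn k (suc n) []       = (k ∷ []) ∷ prependColumn (suc k) n []
prependColumn k (suc n) (r ∷ rs) = (k ∷ r) ∷ prependColumn (suc k) n rs

insert-prependColumn : ∀ k n T {y} → k ≤ y →
  insert y (prependColumn k n T) ≡ prependColumn k n (insert y T)
insert-prependColumn k zero    T        _   = refl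
insert-prependColumn k (suc n) []       k≤y rewrite ≤⇒≮ᵇ k≤y = refl
insert-prependColumn k (suc n) (r ∷ rs) {y} k≤y rewrite ≤⇒≮ᵇ k≤y
  with rowInsert y r in eq
... | r′ , nothing = refl
... | r′ , just z  = cong ((k ∷ r′) ∷_)
  (insert-prependColumn (suc k) n rs (≤-trans (s≤s k≤y) (rowInsert-bumps-larger y r eq)))

insertAll : Tableau → Word → Tableau
insertAll = foldl (flip insert)

insertAll-prependColumn : ∀ k n T {v} → All (k ≤_) v →
  insertAll (prependColumn k n T) v ≡ prependColumn k n (insertAll T v)
insertAll-prependColumn k n T []          = refl
insertAll-prependColumn k n T {x ∷ v} (k≤x ∷ k≤v) rewrite insert-prependColumn k n T k≤x =
  insertAll-prependColumn k n (insert x T) k≤v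

insert-top-of-column : ∀ j n → insert j (prependColumn (suc j) n []) ≡ prependColumn j (suc n) []
insert-top-of-column j zero    = refl
insert-top-of-column j (suc n) rewrite n<ᵇ1+n j = cong ((j ∷ []) ∷_) (insert-top-of-column (suc j) n)

insertAll-δ : ∀ m n → insertAll (prependColumn (suc m) n []) (δ m) ≡ prependColumn 1 (n + m) []
insertAll-δ zero    n rewrite +-identityʳ n = refl
insertAll-δ (suc m) n rewrite insert-top-of-column (suc m) n | +-suc n m = insertAll-δ m (suc n)

P-δ++ : ∀ m {v} → All (1 ≤_) v → P (δ m ++ v) ≡ prependColumn 1 m (P v)
P-δ++ m {v} 1≤v = begin
  P (δ m ++ v)                        ≡⟨ foldl-++ (flip insert) [] (δ m) v ⟩
  insertAll (P (δ m)) v               ≡⟨ cong (flip insertAll v) (insertAll-δ m 0) ⟩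
  insertAll (prependColumn 1 m []) v  ≡⟨ insertAll-prependColumn 1 m [] 1≤v ⟩
  prependColumn 1 m (P v)             ∎
  where open ≡-Reasoning

row-[] : ∀ i → row i [] ≡ []
row-[] zero          = refl
row-[] (suc zero)    = refl
row-[] (suc (suc i)) = refl

row-prependColumn : ∀ i k n T → i < n →
  row (suc i) (prependColumn k n T) ≡ (k + i) ∷ row (suc i) T
row-prependColumn zero    k (suc n) []       _ rewrite +-identityʳ k = refl
row-prependColumn zero    k (suc n) (r ∷ rs) _ rewrite +-identityʳ k = refl
row-prependColumn (suc i) k (suc n) []       (s≤s i<n)
  rewrite row-prependColumn i (suc k) n [] i<n | +-suc k i | row-[] (suc i) = refl
row-prependColumn (suc i) k (suc n) (r ∷ rs) (s≤s i<n)
  rewrite row-prependColumn i (suc k) n rs i<n | +-suc k i = refl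

lemma3p3 : (m : ℕ) → 1 ≤ m → (v : List ℕ) → All (λ a → 1 ≤ a × a ≤ m) v →
    (i : ℕ) → 1 ≤ i → i ≤ m → R i (δ m ++ v) ≡ i ∷ R i v
lemma3p3 m _ v letters (suc i) _ i<m = begin
  row (suc i) (P (δ m ++ v))               ≡⟨ cong (row (suc i)) (P-δ++ m (All.map proj₁ letters)) ⟩
  row (suc i) (prependColumn 1 m (P v))    ≡⟨ row-prependColumn i 1 m (P v) i<m ⟩
  suc i ∷ R (suc i) v                      ∎
  where open ≡-Reasoning
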